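{- Suppose $\Sigma\colon\mathbb{C}\to\mathbb{C}$ preserves strong epimorphisms. Then for every $\Sigma$-algebra $(A,a)$, the diagonal $\Delta_A\rightarrowtail A\times A$ is a congruence, and the composite $R\cdot S$ of any two congruences $R,S$ on $(A,a)$ is a congruence.
   Context: Standing assumptions: $\mathbb{C}$ is complete, has finite coproducts, is well-powered, monomorphisms are stable under finite coproducts, and strong epimorphisms are stable under pullback; every morphism has a (strong epi, mono)-factorization, whose mono part is its image. A relation on $X$ is a subobject $\langle l_R,r_R\rangle\colon R\rightarrowtail X\times X$, ordered by $\le$; $\Delta_A=\langle\mathrm{id},\mathrm{id}\rangle$. For $f\colon X\to Y$, $f_\star[R]$ is the image of $(f\times f)\circ\langle l_R,r_R\rangle$. The composite $R\cdot S$ is the image of $\langle l_R\circ\bar l,r_S\circ\bar r\rangle$ with $(\bar l,\bar r)$ the pullback of $r_R$ and $l_S$. The canonical lifting $\overline\Sigma R$ is the image of $\langle\Sigma l_R,\Sigma r_R\rangle$. A congruence on $(A,a)$ is a relation $R$ on $A$ with $a_\star[\overline\Sigma R]\le R$. -}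

module Defs where

open import Level using (Level; _⊔_) renaming (suc to lsuc)
open import Data.Product using (Σ; Σ-syntax; _×_; _,_; proj₁; proj₂)
open import Relation.Binary using (Rel; IsEquivalence)

record Category (o ℓ e : Level) : Set (lsuc (o ⊔ ℓ ⊔ e)) where
  infixr 9 _∘_
  infix  4 _≈_
  field
    Obj   : Set o
    _⇒_   : Obj → Obj → Set ℓ
    _≈_   : ∀ {A B} → Rel (A ⇒ B) e
    id    : ∀ {A} → A ⇒ A
    _∘_   : ∀ {A B C} → B ⇒ C → A ⇒ B → A ⇒ C
    equiv : ∀ {A B} → IsEquivalence (_≈_ {A} {B})
    assoc : ∀ {A B C D} {f : A ⇒ B} {g : B ⇒ C} {h : C ⇒ D} →
            (h ∘ g) ∘ f ≈ h ∘ (g ∘ f)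
    identityˡ : ∀ {A B} {f : A ⇒ B} → id ∘ f ≈ f
    identityʳ : ∀ {A B} {f : A ⇒ B} → f ∘ id ≈ f
    ∘-resp-≈  : ∀ {A B C} {f h : B ⇒ C} {g i : A ⇒ B} →
                f ≈ h → g ≈ i → f ∘ g ≈ h ∘ i

record Functor {o ℓ e o' ℓ' e' : Level}
               (D : Category o ℓ e) (C : Category o' ℓ' e')
               : Set (o ⊔ ℓ ⊔ e ⊔ o' ⊔ ℓ' ⊔ e') where
  private
    module D = Category D
    module C = Category C
  field
    F₀ : D.Obj → C.Obj
    F₁ : ∀ {A B} → A D.⇒ B → F₀ A C.⇒ F₀ B
    identity     : ∀ {A} → F₁ (D.id {A}) C.≈ C.id
    homomorphism : ∀ {X Y Z} {f : X D.⇒ Y} {g : Y D.⇒ Z} →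
                   F₁ (g D.∘ f) C.≈ F₁ g C.∘ F₁ f
    F-resp-≈     : ∀ {A B} {f g : A D.⇒ B} → f D.≈ g → F₁ f C.≈ F₁ g

Endofunctor : ∀ {o ℓ e} → Category o ℓ e → Set (o ⊔ ℓ ⊔ e)
Endofunctor C = Functor C C

module _ {o ℓ e : Level} (C : Category o ℓ e) where
  open Category C

  Mono : ∀ {A B} → A ⇒ B → Set (o ⊔ ℓ ⊔ e)
  Mono {A} f = ∀ {X} (g h : X ⇒ A) → f ∘ g ≈ f ∘ h → g ≈ h

  Epi : ∀ {A B} → A ⇒ B → Set (o ⊔ ℓ ⊔ e)
  Epi {A} {B} f = ∀ {X} (g h : B ⇒ X) → g ∘ f ≈ h ∘ f → g ≈ h

  record StrongEpi {A B : Obj} (f : A ⇒ B) : Set (o ⊔ ℓ ⊔ e) where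
    field
      epi      : Epi f
      fill-in  : ∀ {X Y} {m : X ⇒ Y} → Mono m →
                 (u : A ⇒ X) (v : B ⇒ Y) → v ∘ f ≈ m ∘ u →
                 Σ[ d ∈ B ⇒ X ] (d ∘ f ≈ u × m ∘ d ≈ v)

  record Factorization {A B : Obj} (f : A ⇒ B) : Set (o ⊔ ℓ ⊔ e) where
    field
      mid       : Obj
      epi-part  : A ⇒ mid
      mono-part : mid ⇒ B
      strong    : StrongEpi epi-part
      mono      : Mono mono-part
      factors   : mono-part ∘ epi-part ≈ f

  record Product (A B : Obj) : Set (o ⊔ ℓ ⊔ e) where
    field
      A×B    : Obj
      π₁     : A×B ⇒ A
      π₂     : A×B ⇒ B
      ⟨_,_⟩  : ∀ {X} → X ⇒ A → X ⇒ B → X ⇒ A×B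
      project₁ : ∀ {X} {f : X ⇒ A} {g : X ⇒ B} → π₁ ∘ ⟨ f , g ⟩ ≈ f
      project₂ : ∀ {X} {f : X ⇒ A} {g : X ⇒ B} → π₂ ∘ ⟨ f , g ⟩ ≈ g
      unique   : ∀ {X} {h : X ⇒ A×B} {f : X ⇒ A} {g : X ⇒ B} →
                 π₁ ∘ h ≈ f → π₂ ∘ h ≈ g → ⟨ f , g ⟩ ≈ h

  record Coproduct (A B : Obj) : Set (o ⊔ ℓ ⊔ e) where
    field
      A+B   : Obj
      i₁    : A ⇒ A+B
      i₂    : B ⇒ A+B
      [_,_] : ∀ {X} → A ⇒ X → B ⇒ X → A+B ⇒ X
      inject₁ : ∀ {X} {f : A ⇒ X} {g : B ⇒ X} → [ f , g ] ∘ i₁ ≈ f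
      inject₂ : ∀ {X} {f : A ⇒ X} {g : B ⇒ X} → [ f , g ] ∘ i₂ ≈ g
      unique  : ∀ {X} {h : A+B ⇒ X} {f : A ⇒ X} {g : B ⇒ X} →
                h ∘ i₁ ≈ f → h ∘ i₂ ≈ g → [ f , g ] ≈ h

  record Initial : Set (o ⊔ ℓ ⊔ e) where
    field
      ⊥  : Obj
      !  : ∀ {X} → ⊥ ⇒ X
      !-unique : ∀ {X} (f : ⊥ ⇒ X) → ! ≈ f

  record IsPullback {P A B X : Obj} (p₁ : P ⇒ A) (p₂ : P ⇒ B)
                    (f : A ⇒ X) (g : B ⇒ X) : Set (o ⊔ ℓ ⊔ e) where
    field
      commute   : f ∘ p₁ ≈ g ∘ p₂
      universal : ∀ {Q} (h₁ : Q ⇒ A) (h₂ : Q ⇒ B) → f ∘ h₁ ≈ g ∘ h₂ →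
                  Σ[ u ∈ Q ⇒ P ] (p₁ ∘ u ≈ h₁ × p₂ ∘ u ≈ h₂)
      unique    : ∀ {Q} (u v : Q ⇒ P) → p₁ ∘ u ≈ p₁ ∘ v → p₂ ∘ u ≈ p₂ ∘ v →
                  u ≈ v

  record Pullback {A B X : Obj} (f : A ⇒ X) (g : B ⇒ X) : Set (o ⊔ ℓ ⊔ e) where
    field
      P  : Obj
      p₁ : P ⇒ A
      p₂ : P ⇒ B
      isPullback : IsPullback p₁ p₂ f g

  module _ {o' ℓ' e' : Level} {J : Category o' ℓ' e'} (D : Functor J C) where
    private module J = Category J
    open Functor D

    record Cone : Set (o ⊔ ℓ ⊔ e ⊔ o' ⊔ ℓ') where
      field
        apex    : Obj
        ψ       : ∀ j → apex ⇒ F₀ j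
        commute : ∀ {i j} (f : i J.⇒ j) → F₁ f ∘ ψ i ≈ ψ j

    record Limit : Set (o ⊔ ℓ ⊔ e ⊔ o' ⊔ ℓ') where
      field
        limit : Cone
      open Cone limit
      field
        factor   : (K : Cone) → Σ[ u ∈ Cone.apex K ⇒ apex ]
                                   (∀ j → ψ j ∘ u ≈ Cone.ψ K j)
        unique   : ∀ {X} (u v : X ⇒ apex) → (∀ j → ψ j ∘ u ≈ ψ j ∘ v) → u ≈ v

  Complete : (o' ℓ' e' : Level) → Set (o ⊔ ℓ ⊔ e ⊔ lsuc (o' ⊔ ℓ' ⊔ e'))
  Complete o' ℓ' e' = (J : Category o' ℓ' e') (D : Functor J C) → Limit D

  record Subobject (X : Obj) : Set (o ⊔ ℓ ⊔ e) where
    field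
      dom  : Obj
      arr  : dom ⇒ X
      mono : Mono arr

  _≤ₛ_ : ∀ {X} → Subobject X → Subobject X → Set (ℓ ⊔ e)
  R ≤ₛ S = Σ[ k ∈ Subobject.dom R ⇒ Subobject.dom S ]
             (Subobject.arr S ∘ k ≈ Subobject.arr R)

  WellPowered : (ℓw : Level) → Set (o ⊔ ℓ ⊔ e ⊔ lsuc ℓw)
  WellPowered ℓw = ∀ X → Σ[ I ∈ Set ℓw ] Σ[ s ∈ (I → Subobject X) ]
                     (∀ (m : Subobject X) → Σ[ i ∈ I ] (m ≤ₛ s i × s i ≤ₛ m))

-- The standing assumptions of the paper on the base category C.
-- Products, coproducts, pullbacks and factorizations are given as chosen
-- data (existence in the constructive sense).

record StandingAssumptions (o' ℓ' e' ℓw : Level) {o ℓ e : Level}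
                           (C : Category o ℓ e)
       : Set (o ⊔ ℓ ⊔ e ⊔ lsuc (o' ⊔ ℓ' ⊔ e' ⊔ ℓw)) where
  open Category C
  field
    complete     : Complete C o' ℓ' e'
    products     : ∀ A B → Product C A B
    pullbacks    : ∀ {A B X} (f : A ⇒ X) (g : B ⇒ X) → Pullback C f g
    initial      : Initial C
    coproducts   : ∀ A B → Coproduct C A B
    well-powered : WellPowered C ℓw
    mono-+       : ∀ {A₁ A₂ B₁ B₂} {m₁ : A₁ ⇒ B₁} {m₂ : A₂ ⇒ B₂} →
                   Mono C m₁ → Mono C m₂ →
                   Mono C (Coproduct.[_,_] (coproducts A₁ A₂)
                             (Coproduct.i₁ (coproducts B₁ B₂) ∘ m₁)
                             (Coproduct.i₂ (coproducts B₁ B₂) ∘ m₂))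
    strongEpi-pullback : ∀ {P A B X} {p₁ : P ⇒ A} {p₂ : P ⇒ B}
                           {f : A ⇒ X} {g : B ⇒ X} →
                         IsPullback C p₁ p₂ f g → StrongEpi C f →
                         StrongEpi C p₂
    factorization : ∀ {A B} (f : A ⇒ B) → Factorization C f

module Relations {o' ℓ' e' ℓw o ℓ e : Level} {C : Category o ℓ e}
                 (SA : StandingAssumptions o' ℓ' e' ℓw C) where
  open Category C
  open StandingAssumptions SA

  infixr 30 _×₀_
  _×₀_ : Obj → Obj → Obj
  A ×₀ B = Product.A×B (products A B)

  π₁ : ∀ {A B} → A ×₀ B ⇒ A
  π₁ {A} {B} = Product.π₁ (products A B)

  π₂ : ∀ {A B} → A ×₀ B ⇒ B
  π₂ {A} {B} = Product.π₂ (products A B)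

  ⟨_,_⟩ : ∀ {X A B} → X ⇒ A → X ⇒ B → X ⇒ A ×₀ B
  ⟨_,_⟩ {X} {A} {B} = Product.⟨_,_⟩ (products A B)

  _⊗_ : ∀ {X Y X' Y'} → X ⇒ Y → X' ⇒ Y' → X ×₀ X' ⇒ Y ×₀ Y'
  f ⊗ g = ⟨ f ∘ π₁ , g ∘ π₂ ⟩

  Relation : Obj → Set (o ⊔ ℓ ⊔ e)
  Relation X = Subobject C (X ×₀ X)

  lᴿ : ∀ {X} (R : Relation X) → Subobject.dom R ⇒ X
  lᴿ R = π₁ ∘ Subobject.arr R

  rᴿ : ∀ {X} (R : Relation X) → Subobject.dom R ⇒ X
  rᴿ R = π₂ ∘ Subobject.arr R

  _≤_ : ∀ {X} → Relation X → Relation X → Set (ℓ ⊔ e)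
  _≤_ = _≤ₛ_ C

  image : ∀ {A B} → A ⇒ B → Subobject C B
  image f = record { dom  = Factorization.mid (factorization f)
                   ; arr  = Factorization.mono-part (factorization f)
                   ; mono = Factorization.mono (factorization f) }

  -- the diagonal ⟨id , id⟩ (a split mono)
  Δ-mono : ∀ {A} → Mono C (⟨ id {A} , id {A} ⟩)
  Δ-mono {A} {X} g h eq =
    trans (sym' identityˡ)
    (trans (∘-resp-≈ (sym' p₁) refl')
    (trans (assoc {f = g} {g = d} {h = π₁})
    (trans (∘-resp-≈ {f = π₁} {h = π₁} refl' eq)
    (trans (sym' (assoc {f = h} {g = d} {h = π₁}))
    (trans (∘-resp-≈ p₁ refl')
    identityˡ)))))
    where
      open IsEquivalence (equiv {X} {A}) using (trans)
      sym' : ∀ {U V} {x y : U ⇒ V} → x ≈ y → y ≈ x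
      sym' = IsEquivalence.sym equiv
      refl' : ∀ {U V} {x : U ⇒ V} → x ≈ x
      refl' = IsEquivalence.refl equiv
      d : A ⇒ A ×₀ A
      d = ⟨ id , id ⟩
      p₁ : π₁ ∘ d ≈ id
      p₁ = Product.project₁ (products A A)

  Δ : ∀ A → Relation A
  Δ A = record { dom = A ; arr = ⟨ id , id ⟩ ; mono = Δ-mono }

  _⋆[_] : ∀ {X Y} → X ⇒ Y → Relation X → Relation Y
  f ⋆[ R ] = image ((f ⊗ f) ∘ Subobject.arr R)

  _·_ : ∀ {X} → Relation X → Relation X → Relation X
  R · S = image ⟨ lᴿ R ∘ Pullback.p₁ pb , rᴿ S ∘ Pullback.p₂ pb ⟩
    where pb = pullbacks (rᴿ R) (lᴿ S)

  module _ (F : Endofunctor C) where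
    open Functor F

    lift : ∀ {X} → Relation X → Relation (F₀ X)
    lift R = image ⟨ F₁ (lᴿ R) , F₁ (rᴿ R) ⟩

    record Algebra : Set (o ⊔ ℓ) where
      field
        carrier : Obj
        structure : F₀ carrier ⇒ carrier

    IsCongruence : (alg : Algebra) → Relation (Algebra.carrier alg) → Set (ℓ ⊔ e)
    IsCongruence alg R = (Algebra.structure alg ⋆[ lift R ]) ≤ R

PreservesStrongEpis : ∀ {o ℓ e} {C : Category o ℓ e} → Endofunctor C →
                      Set (o ⊔ ℓ ⊔ e)
PreservesStrongEpis {C = C} F =
  ∀ {A B} {f : Category._⇒_ C A B} → StrongEpi C f → StrongEpi C (Functor.F₁ F f)

-- R is a congruence exactly when its domain carries a Σ-structure making both legs
-- l_R, r_R homomorphisms into (A, a).  The diagonal has the structure a itself.  For R · S,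
-- the pullback of r_R and l_S inherits a structure from those of R and S, so the span
-- ⟨l_R p₁, r_S p₂⟩ has homomorphic legs; as Σ preserves the strong epi part e of its
-- (strong epi, mono)-factorization, diagonal fill-in against the mono part moves the
-- structure along Σ e onto the image, which is R · S.
module Submission where

open import Defs
open import Level using (Level; _⊔_)
open import Data.Product using (Σ-syntax; _×_; _,_)
open import Relation.Binary using (IsEquivalence; Setoid)
import Relation.Binary.Reasoning.Setoid as SetoidReasoning

module AlgebraFacts {o' ℓ' e' ℓw o ℓ e : Level} {C : Category o ℓ e}
                    (SA : StandingAssumptions o' ℓ' e' ℓw C) (F : Endofunctor C) where
  open Category C
  open StandingAssumptions SA
  open Relations SA
  open Functor F

  module _ {X Y : Obj} where
    open IsEquivalence (equiv {X} {Y}) public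
      renaming (refl to ≈-refl; sym to ≈-sym; trans to ≈-trans)

  hom-setoid : Obj → Obj → Setoid ℓ e
  hom-setoid X Y = record { Carrier = X ⇒ Y ; _≈_ = _≈_ ; isEquivalence = equiv }

  strongEpi-lift : ∀ {P Q X Y} {f : P ⇒ Q} {m : X ⇒ Y} → StrongEpi C f → Mono C m →
                   (u : P ⇒ X) (v : Q ⇒ Y) → v ∘ f ≈ m ∘ u → Σ[ d ∈ Q ⇒ X ] (m ∘ d ≈ v)
  strongEpi-lift f-strong m-mono u v square
    with StrongEpi.fill-in f-strong m-mono u v square
  ... | d , _ , m∘d≈v = d , m∘d≈v

  image-least : ∀ {X B} {f : X ⇒ B} (S : Subobject C B) (g : X ⇒ Subobject.dom S) →
                Subobject.arr S ∘ g ≈ f → _≤ₛ_ C (image f) S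
  image-least {f = f} S g factors-through =
    strongEpi-lift (Factorization.strong fac) (Subobject.mono S) g
                   (Factorization.mono-part fac)
                   (≈-trans (Factorization.factors fac) (≈-sym factors-through))
    where fac = factorization f

  project₁ : ∀ {X A B} {f : X ⇒ A} {g : X ⇒ B} → π₁ ∘ ⟨ f , g ⟩ ≈ f
  project₁ {A = A} {B} = Product.project₁ (products A B)

  project₂ : ∀ {X A B} {f : X ⇒ A} {g : X ⇒ B} → π₂ ∘ ⟨ f , g ⟩ ≈ g
  project₂ {A = A} {B} = Product.project₂ (products A B)

  π-ext : ∀ {X A B} {g h : X ⇒ A ×₀ B} → π₁ ∘ g ≈ π₁ ∘ h → π₂ ∘ g ≈ π₂ ∘ h → g ≈ h
  π-ext {A = A} {B} π₁-eq π₂-eq =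
    ≈-trans (≈-sym (Product.unique (products A B) π₁-eq π₂-eq))
            (Product.unique (products A B) ≈-refl ≈-refl)

  π₁-⊗-⟨⟩ : ∀ {X A B A' B'} {g : A ⇒ A'} {h : B ⇒ B'} {p : X ⇒ A} {q : X ⇒ B} →
            π₁ ∘ (g ⊗ h) ∘ ⟨ p , q ⟩ ≈ g ∘ p
  π₁-⊗-⟨⟩ {X} {A' = A'} {g = g} {h} {p} {q} = begin
    π₁ ∘ (g ⊗ h) ∘ ⟨ p , q ⟩   ≈⟨ ≈-sym assoc ⟩
    (π₁ ∘ (g ⊗ h)) ∘ ⟨ p , q ⟩ ≈⟨ ∘-resp-≈ project₁ ≈-refl ⟩
    (g ∘ π₁) ∘ ⟨ p , q ⟩       ≈⟨ assoc ⟩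
    g ∘ π₁ ∘ ⟨ p , q ⟩         ≈⟨ ∘-resp-≈ ≈-refl project₁ ⟩
    g ∘ p                      ∎
    where open SetoidReasoning (hom-setoid X A')

  π₂-⊗-⟨⟩ : ∀ {X A B A' B'} {g : A ⇒ A'} {h : B ⇒ B'} {p : X ⇒ A} {q : X ⇒ B} →
            π₂ ∘ (g ⊗ h) ∘ ⟨ p , q ⟩ ≈ h ∘ q
  π₂-⊗-⟨⟩ {X} {B' = B'} {g = g} {h} {p} {q} = begin
    π₂ ∘ (g ⊗ h) ∘ ⟨ p , q ⟩   ≈⟨ ≈-sym assoc ⟩
    (π₂ ∘ (g ⊗ h)) ∘ ⟨ p , q ⟩ ≈⟨ ∘-resp-≈ project₂ ≈-refl ⟩
    (h ∘ π₂) ∘ ⟨ p , q ⟩       ≈⟨ assoc ⟩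
    h ∘ π₂ ∘ ⟨ p , q ⟩         ≈⟨ ∘-resp-≈ ≈-refl project₂ ⟩
    h ∘ q                      ∎
    where open SetoidReasoning (hom-setoid X B')

  Homomorphic : ∀ {X Y} → F₀ X ⇒ X → F₀ Y ⇒ Y → X ⇒ Y → Set e
  Homomorphic x y g = g ∘ x ≈ y ∘ F₁ g

  homomorphic-resp-≈ : ∀ {X Y} {x : F₀ X ⇒ X} {y : F₀ Y ⇒ Y} {g g' : X ⇒ Y} →
                       g ≈ g' → Homomorphic x y g → Homomorphic x y g'
  homomorphic-resp-≈ g≈g' g-hom =
    ≈-trans (∘-resp-≈ (≈-sym g≈g') ≈-refl)
            (≈-trans g-hom (∘-resp-≈ ≈-refl (F-resp-≈ g≈g')))

  id-homomorphic : ∀ {X} {x : F₀ X ⇒ X} → Homomorphic x x id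
  id-homomorphic =
    ≈-trans identityˡ (≈-trans (≈-sym identityʳ) (∘-resp-≈ ≈-refl (≈-sym identity)))

  ∘-homomorphic : ∀ {X Y Z} {x : F₀ X ⇒ X} {y : F₀ Y ⇒ Y} {z : F₀ Z ⇒ Z}
                    {g : Y ⇒ Z} {f : X ⇒ Y} →
                  Homomorphic y z g → Homomorphic x y f → Homomorphic x z (g ∘ f)
  ∘-homomorphic {X} {Z = Z} {x} {y} {z} {g} {f} g-hom f-hom = begin
    (g ∘ f) ∘ x        ≈⟨ assoc ⟩
    g ∘ f ∘ x          ≈⟨ ∘-resp-≈ ≈-refl f-hom ⟩
    g ∘ y ∘ F₁ f       ≈⟨ ≈-sym assoc ⟩
    (g ∘ y) ∘ F₁ f     ≈⟨ ∘-resp-≈ g-hom ≈-refl ⟩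
    (z ∘ F₁ g) ∘ F₁ f  ≈⟨ assoc ⟩
    z ∘ F₁ g ∘ F₁ f    ≈⟨ ∘-resp-≈ ≈-refl (≈-sym homomorphism) ⟩
    z ∘ F₁ (g ∘ f)     ∎
    where open SetoidReasoning (hom-setoid (F₀ X) Z)

  pullback-structure : ∀ {P X Y Z} {p₁ : P ⇒ X} {p₂ : P ⇒ Y} {f : X ⇒ Z} {g : Y ⇒ Z}
                         {x : F₀ X ⇒ X} {y : F₀ Y ⇒ Y} {z : F₀ Z ⇒ Z} →
                       IsPullback C p₁ p₂ f g → Homomorphic x z f → Homomorphic y z g →
                       Σ[ w ∈ F₀ P ⇒ P ] (Homomorphic w x p₁ × Homomorphic w y p₂)
  pullback-structure {P} {Z = Z} {p₁} {p₂} {f} {g} {x} {y} {z} pb f-hom g-hom =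
    IsPullback.universal pb (x ∘ F₁ p₁) (y ∘ F₁ p₂) cone
    where
      open SetoidReasoning (hom-setoid (F₀ P) Z)
      cone : f ∘ x ∘ F₁ p₁ ≈ g ∘ y ∘ F₁ p₂
      cone = begin
        f ∘ x ∘ F₁ p₁       ≈⟨ ≈-sym assoc ⟩
        (f ∘ x) ∘ F₁ p₁     ≈⟨ ∘-resp-≈ f-hom ≈-refl ⟩
        (z ∘ F₁ f) ∘ F₁ p₁  ≈⟨ assoc ⟩
        z ∘ F₁ f ∘ F₁ p₁    ≈⟨ ∘-resp-≈ ≈-refl (≈-sym homomorphism) ⟩
        z ∘ F₁ (f ∘ p₁)     ≈⟨ ∘-resp-≈ ≈-refl (F-resp-≈ (IsPullback.commute pb)) ⟩
        z ∘ F₁ (g ∘ p₂)     ≈⟨ ∘-resp-≈ ≈-refl homomorphism ⟩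
        z ∘ F₁ g ∘ F₁ p₂    ≈⟨ ≈-sym assoc ⟩
        (z ∘ F₁ g) ∘ F₁ p₂  ≈⟨ ∘-resp-≈ (≈-sym g-hom) ≈-refl ⟩
        (g ∘ y) ∘ F₁ p₂     ≈⟨ assoc ⟩
        g ∘ y ∘ F₁ p₂       ∎

  module _ (alg : Algebra F) where
    open Algebra alg renaming (carrier to A; structure to a)

    HomomorphicSpan : ∀ {X} → X ⇒ A ×₀ A → Set (ℓ ⊔ e)
    HomomorphicSpan {X} f =
      Σ[ x ∈ F₀ X ⇒ X ] (Homomorphic x a (π₁ ∘ f) × Homomorphic x a (π₂ ∘ f))

    legs-homomorphic : ∀ {X} {f : X ⇒ A ×₀ A} {x : F₀ X ⇒ X} →
                       f ∘ x ≈ (a ⊗ a) ∘ ⟨ F₁ (π₁ ∘ f) , F₁ (π₂ ∘ f) ⟩ →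
                       HomomorphicSpan f
    legs-homomorphic {x = x} eq =
      x , ≈-trans assoc (≈-trans (∘-resp-≈ ≈-refl eq) π₁-⊗-⟨⟩)
        , ≈-trans assoc (≈-trans (∘-resp-≈ ≈-refl eq) π₂-⊗-⟨⟩)

    span-equation : ∀ {X} {f : X ⇒ A ×₀ A} {x : F₀ X ⇒ X} →
                    Homomorphic x a (π₁ ∘ f) → Homomorphic x a (π₂ ∘ f) →
                    f ∘ x ≈ (a ⊗ a) ∘ ⟨ F₁ (π₁ ∘ f) , F₁ (π₂ ∘ f) ⟩
    span-equation π₁-hom π₂-hom =
      π-ext (≈-trans (≈-sym assoc) (≈-trans π₁-hom (≈-sym π₁-⊗-⟨⟩)))
            (≈-trans (≈-sym assoc) (≈-trans π₂-hom (≈-sym π₂-⊗-⟨⟩)))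

    congruence⇒homomorphicSpan : (R : Relation A) → IsCongruence F alg R →
                                 HomomorphicSpan (Subobject.arr R)
    congruence⇒homomorphicSpan R (k , k-factors) = legs-homomorphic eq
      where
        mR = Subobject.arr R
        fac₁ = factorization ⟨ F₁ (lᴿ R) , F₁ (rᴿ R) ⟩
        n₁ = Factorization.mono-part fac₁
        e₁ = Factorization.epi-part fac₁
        fac₂ = factorization ((a ⊗ a) ∘ n₁)
        n₂ = Factorization.mono-part fac₂
        e₂ = Factorization.epi-part fac₂
        open SetoidReasoning (hom-setoid (F₀ (Subobject.dom R)) (A ×₀ A))
        eq : mR ∘ k ∘ e₂ ∘ e₁ ≈ (a ⊗ a) ∘ ⟨ F₁ (lᴿ R) , F₁ (rᴿ R) ⟩
        eq = begin
          mR ∘ k ∘ e₂ ∘ e₁      ≈⟨ ≈-sym assoc ⟩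
          (mR ∘ k) ∘ e₂ ∘ e₁    ≈⟨ ∘-resp-≈ k-factors ≈-refl ⟩
          n₂ ∘ e₂ ∘ e₁          ≈⟨ ≈-sym assoc ⟩
          (n₂ ∘ e₂) ∘ e₁        ≈⟨ ∘-resp-≈ (Factorization.factors fac₂) ≈-refl ⟩
          ((a ⊗ a) ∘ n₁) ∘ e₁   ≈⟨ assoc ⟩
          (a ⊗ a) ∘ n₁ ∘ e₁     ≈⟨ ∘-resp-≈ ≈-refl (Factorization.factors fac₁) ⟩
          (a ⊗ a) ∘ ⟨ F₁ (lᴿ R) , F₁ (rᴿ R) ⟩ ∎

    homomorphicSpan⇒congruence : (R : Relation A) → HomomorphicSpan (Subobject.arr R) →
                                 IsCongruence F alg R
    homomorphicSpan⇒congruence R (x , l-hom , r-hom) with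
      strongEpi-lift (Factorization.strong fac₁) (Subobject.mono R) x ((a ⊗ a) ∘ n₁) square
      where
        fac₁ = factorization ⟨ F₁ (lᴿ R) , F₁ (rᴿ R) ⟩
        n₁ = Factorization.mono-part fac₁
        square : ((a ⊗ a) ∘ n₁) ∘ Factorization.epi-part fac₁ ≈ Subobject.arr R ∘ x
        square = ≈-trans assoc
                   (≈-trans (∘-resp-≈ ≈-refl (Factorization.factors fac₁))
                            (≈-sym (span-equation l-hom r-hom)))
    ... | d , d-factors = image-least R d d-factors

    image-homomorphicSpan : PreservesStrongEpis F → ∀ {X} {f : X ⇒ A ×₀ A} →
                            HomomorphicSpan f → HomomorphicSpan (Subobject.arr (image f))
    image-homomorphicSpan preserves {X} {f} (x , π₁-hom , π₂-hom)
      with strongEpi-lift (preserves (Factorization.strong fac)) (Factorization.mono fac)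
                          (ε ∘ x) v square
      where
        fac = factorization f
        m = Factorization.mono-part fac
        ε = Factorization.epi-part fac
        v = (a ⊗ a) ∘ ⟨ F₁ (π₁ ∘ m) , F₁ (π₂ ∘ m) ⟩
        leg : ∀ {π : A ×₀ A ⇒ A} → π ∘ v ≈ a ∘ F₁ (π ∘ m) → Homomorphic x a (π ∘ f) →
              π ∘ v ∘ F₁ ε ≈ π ∘ m ∘ ε ∘ x
        leg {π} π∘v π-hom = begin
          π ∘ v ∘ F₁ ε             ≈⟨ ≈-sym assoc ⟩
          (π ∘ v) ∘ F₁ ε           ≈⟨ ∘-resp-≈ π∘v ≈-refl ⟩
          (a ∘ F₁ (π ∘ m)) ∘ F₁ ε  ≈⟨ assoc ⟩
          a ∘ F₁ (π ∘ m) ∘ F₁ ε    ≈⟨ ∘-resp-≈ ≈-refl (≈-sym homomorphism) ⟩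
          a ∘ F₁ ((π ∘ m) ∘ ε)     ≈⟨ ≈-sym π∘m∘ε-hom ⟩
          ((π ∘ m) ∘ ε) ∘ x        ≈⟨ assoc ⟩
          (π ∘ m) ∘ ε ∘ x          ≈⟨ assoc ⟩
          π ∘ m ∘ ε ∘ x            ∎
          where
            open SetoidReasoning (hom-setoid (F₀ X) A)
            π∘m∘ε-hom : Homomorphic x a ((π ∘ m) ∘ ε)
            π∘m∘ε-hom = homomorphic-resp-≈
              (≈-trans (∘-resp-≈ ≈-refl (≈-sym (Factorization.factors fac))) (≈-sym assoc))
              π-hom
        square : v ∘ F₁ ε ≈ m ∘ ε ∘ x
        square = π-ext (leg π₁-⊗-⟨⟩ π₁-hom) (leg π₂-⊗-⟨⟩ π₂-hom)
    ... | d , d-factors = legs-homomorphic d-factors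

    composite-homomorphicSpan : (R S : Relation A) →
      HomomorphicSpan (Subobject.arr R) → HomomorphicSpan (Subobject.arr S) →
      let pb = pullbacks (rᴿ R) (lᴿ S) in
      HomomorphicSpan ⟨ lᴿ R ∘ Pullback.p₁ pb , rᴿ S ∘ Pullback.p₂ pb ⟩
    composite-homomorphicSpan R S (_ , lR-hom , rR-hom) (_ , lS-hom , rS-hom)
      with pullback-structure (Pullback.isPullback (pullbacks (rᴿ R) (lᴿ S))) rR-hom lS-hom
    ... | w , p₁-hom , p₂-hom =
      w , homomorphic-resp-≈ (≈-sym project₁) (∘-homomorphic lR-hom p₁-hom)
        , homomorphic-resp-≈ (≈-sym project₂) (∘-homomorphic rS-hom p₂-hom)

    Δ-congruence : IsCongruence F alg (Δ A)
    Δ-congruence = homomorphicSpan⇒congruence (Δ A)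
      (a , homomorphic-resp-≈ (≈-sym project₁) id-homomorphic
         , homomorphic-resp-≈ (≈-sym project₂) id-homomorphic)

    ·-congruence : PreservesStrongEpis F → (R S : Relation A) →
                   IsCongruence F alg R → IsCongruence F alg S → IsCongruence F alg (R · S)
    ·-congruence preserves R S R-congruence S-congruence =
      homomorphicSpan⇒congruence (R · S)
        (image-homomorphicSpan preserves
          (composite-homomorphicSpan R S
            (congruence⇒homomorphicSpan R R-congruence)
            (congruence⇒homomorphicSpan S S-congruence)))

lemmaB7 : ∀ {o ℓ e : Level} (o' ℓ' e' ℓw : Level) (C : Category o ℓ e)
            (SA : StandingAssumptions o' ℓ' e' ℓw C) (F : Endofunctor C) →
            PreservesStrongEpis F →
            (alg : Relations.Algebra SA F) →
            Relations.IsCongruence SA F alg (Relations.Δ SA (Relations.Algebra.carrier alg))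
            × (∀ (R S : Relations.Relation SA (Relations.Algebra.carrier alg)) →
                 Relations.IsCongruence SA F alg R →
                 Relations.IsCongruence SA F alg S →
                 Relations.IsCongruence SA F alg (Relations._·_ SA R S))
lemmaB7 o' ℓ' e' ℓw C SA F preserves alg = Δ-congruence alg , ·-congruence alg preserves
  where open AlgebraFacts SA F
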